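{- Let $R$ be an integral domain with $1$, let $d\ge 0$ and let $p(t)=a_0+a_1t+\cdots+a_dt^d\in R[t]$ be a polynomial of degree $d$ (so $a_d\neq 0$) with $a_0\neq 0$. For every integer $k\ge 0$ write $$\frac{(tp(t))^k}{1-t^{d+1}}=\sum_{i\ge 0} C_{i,k}\,t^i\in R[[t]].$$ Then for every integer $k\ge 0$ the sequence $\{C_{i,k}\}_{i\ge 0}$ is eventually periodic with period $d+1$, the periodicity starting at the $(1+(k-1)(d+1))$-st place; that is, for every integer $n\ge 0$, $$C_{1+(k-1)(d+1)+n,\,k}=C_{1+k(d+1)+n,\,k}.$$
   Context: $C_{i,k}$ is the entry in row $i$, column $k$ (rows and columns indexed from $0$) of the Riordan array $\bigl(1/(1-t^{d+1}),\,tp(t)\bigr)$, i.e. the infinite lower triangular matrix whose $k$-th column has generating function $(tp(t))^k/(1-t^{d+1})$. Coefficients of power series at negative indices are taken to be $0$ (relevant only for $k=0$). -}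

module Defs where

open import Level using (Level; _⊔_)
open import Algebra.Bundles using (CommutativeRing)
open import Data.Nat as ℕ using (ℕ; zero; suc; _∸_; _<?_; _%_)
open import Data.Nat.Properties using ()
open import Data.Fin using (Fin; fromℕ<; fromℕ)
open import Data.Integer as ℤ using (ℤ; +_; -[1+_])
open import Data.Sum using (_⊎_)
open import Relation.Nullary using (¬_; yes; no)
open import Relation.Binary.PropositionalEquality using (_≡_)

record IsIntegralDomain {c ℓ : Level} (R : CommutativeRing c ℓ) : Set (c ⊔ ℓ) where
  open CommutativeRing R using (Carrier; _≈_; _+_; _*_; 0#; 1#)
  field
    1≉0 : ¬ (1# ≈ 0#)
    noZeroDivisors : ∀ x y → x * y ≈ 0# → (x ≈ 0#) ⊎ (y ≈ 0#)

module Series {c ℓ : Level} (R : CommutativeRing c ℓ) where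
  open CommutativeRing R using (Carrier; _≈_; _+_; _*_; 0#; 1#)

  PS : Set c
  PS = ℕ → Carrier

  sumTo : ℕ → (ℕ → Carrier) → Carrier
  sumTo zero    f = f zero
  sumTo (suc n) f = sumTo n f + f (suc n)

  _·_ : PS → PS → PS
  (f · g) i = sumTo i (λ j → f j * g (i ∸ j))

  one : PS
  one zero    = 1#
  one (suc _) = 0#

  _^ₛ_ : PS → ℕ → PS
  f ^ₛ zero  = one
  f ^ₛ suc k = f · (f ^ₛ k)

  poly : (d : ℕ) → (Fin (suc d) → Carrier) → PS
  poly d a i with i <? suc d
  ... | yes i<d+1 = a (fromℕ< i<d+1)
  ... | no  _     = 0#

  shiftT : PS → PS
  shiftT f zero    = 0#
  shiftT f (suc i) = f i

  -- 1/(1 - t^(d+1)) = Σ_m t^(m(d+1))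
  geom : ℕ → PS
  geom d i with i % suc d
  ... | zero  = 1#
  ... | suc _ = 0#

  C : (d : ℕ) → (Fin (suc d) → Carrier) → ℕ → ℕ → Carrier
  C d a i k = ((shiftT (poly d a) ^ₛ k) · geom d) i

  Cℤ : (d : ℕ) → (Fin (suc d) → Carrier) → ℤ → ℕ → Carrier
  Cℤ d a (+ i)      k = C d a i k
  Cℤ d a -[1+ _ ]   k = 0#

{-# OPTIONS --safe #-}
-- With D = d + 1 the series G = 1/(1 - t^D) satisfies G = 1 + t^D G, so the coefficients
-- of u G obey [t^(i+D)] u G = [t^i] u G + [t^(i+D)] u for every series u.  For u = (t p)^k,
-- a polynomial of degree ≤ k D, the correction vanishes as soon as i + D > k D, i.e. from
-- i = 1 + (k - 1) D on.  When k = 0 that starting point is negative: there the left-hand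
-- side is 0 by convention and the right-hand index lies in [1, d], where [t^i] G = 0.
module Submission where

open import Defs
open import Level using (Level)
open import Algebra.Bundles using (CommutativeRing)
open import Data.Nat as ℕ using (ℕ; zero; suc; _≤_; _<_; z≤n; s≤s; _≤?_; _<?_; _∸_; _%_)
open import Data.Nat.Properties as ℕ
  using (≤-refl; ≤-trans; m≤n⇒m≤1+n; <⇒≱; ≰⇒>; n∸n≡0; m∸n≤m; +-∸-assoc; +-∸-comm; m+n≤o⇒m≤o∸n;
         [m+n]∸[m+o]≡n∸o; m<n⇒0<n∸m)
open import Data.Nat.DivMod using ([m+n]%n≡m%n; m<n⇒m%n≡m)
open import Data.Fin using (Fin; fromℕ)
open import Data.Empty using (⊥-elim)
open import Relation.Nullary using (¬_; yes; no)
open import Relation.Binary.PropositionalEquality as ≡ using (_≡_; cong)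

module SeriesProperties {c ℓ} (R : CommutativeRing c ℓ) where
  open CommutativeRing R
    using (Carrier; _≈_; 0#; 1#; setoid; refl; sym; trans; reflexive; +-cong; *-cong; +-assoc;
           +-identityˡ; +-identityʳ; *-identityʳ; zeroˡ; zeroʳ)
    renaming (_+_ to _+ᴿ_; _*_ to _*ᴿ_)
  open Series R
  open import Relation.Binary.Reasoning.Setoid setoid

  sumTo-cong : ∀ n {f g : ℕ → Carrier} → (∀ j → j ≤ n → f j ≈ g j) → sumTo n f ≈ sumTo n g
  sumTo-cong zero    f≈g = f≈g 0 z≤n
  sumTo-cong (suc n) f≈g =
    +-cong (sumTo-cong n (λ j j≤n → f≈g j (m≤n⇒m≤1+n j≤n))) (f≈g (suc n) ≤-refl)

  sumTo-zero : ∀ n {f : ℕ → Carrier} → (∀ j → j ≤ n → f j ≈ 0#) → sumTo n f ≈ 0#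
  sumTo-zero zero    f≈0 = f≈0 0 z≤n
  sumTo-zero (suc n) f≈0 =
    trans (+-cong (sumTo-zero n (λ j j≤n → f≈0 j (m≤n⇒m≤1+n j≤n))) (f≈0 (suc n) ≤-refl))
          (+-identityʳ 0#)

  sumTo-split : ∀ m n (f : ℕ → Carrier) →
    sumTo (m ℕ.+ suc n) f ≈ sumTo m f +ᴿ sumTo n (λ j → f (m ℕ.+ suc j))
  sumTo-split m zero    f rewrite ℕ.+-comm m 1 = refl
  sumTo-split m (suc n) f rewrite ℕ.+-suc m (suc n) =
    trans (+-cong (sumTo-split m n f) refl) (+-assoc _ _ _)

  VanishesAbove : ℕ → PS → Set ℓ
  VanishesAbove n f = ∀ i → n < i → f i ≈ 0#

  one-vanishesAbove : VanishesAbove 0 one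
  one-vanishesAbove (suc i) _ = refl

  shiftT-vanishesAbove : ∀ {n f} → VanishesAbove n f → VanishesAbove (suc n) (shiftT f)
  shiftT-vanishesAbove f-van (suc i) (s≤s n<i) = f-van i n<i

  poly-vanishesAbove : ∀ d a → VanishesAbove d (poly d a)
  poly-vanishesAbove d a i d<i with i <? suc d
  ... | yes i<1+d = ⊥-elim (<⇒≱ (s≤s d<i) i<1+d)
  ... | no  _   = refl

  ·-vanishesAbove : ∀ {m n f g} → VanishesAbove m f → VanishesAbove n g →
                    VanishesAbove (m ℕ.+ n) (f · g)
  ·-vanishesAbove {m} {n} {f} {g} f-van g-van i m+n<i = sumTo-zero i term
    where
    term : ∀ j → j ≤ i → f j *ᴿ g (i ∸ j) ≈ 0#
    term j _ with j ≤? m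
    ... | no  j≰m = trans (*-cong (f-van j (≰⇒> j≰m)) refl) (zeroˡ _)
    ... | yes j≤m = trans (*-cong refl (g-van (i ∸ j) n<i∸j)) (zeroʳ _)
      where
      n<i∸j : n < i ∸ j
      n<i∸j = m+n≤o⇒m≤o∸n (suc n)
        (≤-trans (ℕ.+-monoʳ-≤ (suc n) j≤m) (≤-trans (ℕ.≤-reflexive (cong suc (ℕ.+-comm n m))) m+n<i))

  ^ₛ-vanishesAbove : ∀ {m f} → VanishesAbove m f → ∀ k → VanishesAbove (k ℕ.* m) (f ^ₛ k)
  ^ₛ-vanishesAbove f-van zero    = one-vanishesAbove
  ^ₛ-vanishesAbove f-van (suc k) = ·-vanishesAbove f-van (^ₛ-vanishesAbove f-van k)

  geom≡one∘% : ∀ d i → geom d i ≡ one (i % suc d)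
  geom≡one∘% d i with i % suc d
  ... | zero  = ≡.refl
  ... | suc _ = ≡.refl

  geom-periodic : ∀ d i → geom d (i ℕ.+ suc d) ≡ geom d i
  geom-periodic d i = ≡.trans (geom≡one∘% d (i ℕ.+ suc d))
                        (≡.trans (cong one ([m+n]%n≡m%n i (suc d))) (≡.sym (geom≡one∘% d i)))

  geom-vanishes : ∀ d i → 0 < i → i ≤ d → geom d i ≡ 0#
  geom-vanishes d (suc i) _ i<d = ≡.trans (geom≡one∘% d (suc i)) (cong one (m<n⇒m%n≡m (s≤s i<d)))

  ·-geom-≤ : ∀ d u {e} → e ≤ d → (u · geom d) e ≈ u e
  ·-geom-≤ d u {zero}  _   = *-identityʳ (u 0)
  ·-geom-≤ d u {suc e} e<d = begin
    sumTo e (λ j → u j *ᴿ geom d (suc e ∸ j)) +ᴿ u (suc e) *ᴿ geom d (e ∸ e)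
      ≈⟨ +-cong (sumTo-zero e earlier) (*-cong refl (reflexive (cong (geom d) (n∸n≡0 e)))) ⟩
    0# +ᴿ u (suc e) *ᴿ 1#
      ≈⟨ +-identityˡ _ ⟩
    u (suc e) *ᴿ 1#
      ≈⟨ *-identityʳ _ ⟩
    u (suc e) ∎
    where
    earlier : ∀ j → j ≤ e → u j *ᴿ geom d (suc e ∸ j) ≈ 0#
    earlier j j≤e = trans (*-cong refl (reflexive (≡.trans (cong (geom d) (+-∸-assoc 1 j≤e))
                      (geom-vanishes d (suc (e ∸ j)) (s≤s z≤n) (≤-trans (s≤s (m∸n≤m e j)) e<d)))))
                      (zeroʳ _)

  ·-geom-step : ∀ d u i → (u · geom d) (i ℕ.+ suc d) ≈ (u · geom d) i +ᴿ u (i ℕ.+ suc d)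
  ·-geom-step d u i = begin
    (u · geom d) (i ℕ.+ suc d)
      ≈⟨ sumTo-split i d (λ j → u j *ᴿ geom d (i ℕ.+ suc d ∸ j)) ⟩
    sumTo i (λ j → u j *ᴿ geom d (i ℕ.+ suc d ∸ j))
      +ᴿ sumTo d (λ j → u (i ℕ.+ suc j) *ᴿ geom d (i ℕ.+ suc d ∸ (i ℕ.+ suc j)))
      ≈⟨ +-cong (sumTo-cong i early) (sumTo-cong d late) ⟩
    (u · geom d) i +ᴿ ((λ j → u (i ℕ.+ suc j)) · geom d) d
      ≈⟨ +-cong refl (·-geom-≤ d (λ j → u (i ℕ.+ suc j)) ≤-refl) ⟩
    (u · geom d) i +ᴿ u (i ℕ.+ suc d) ∎
    where
    early : ∀ j → j ≤ i → u j *ᴿ geom d (i ℕ.+ suc d ∸ j) ≈ u j *ᴿ geom d (i ∸ j)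
    early j j≤i = *-cong refl (reflexive (≡.trans (cong (geom d) (+-∸-comm (suc d) j≤i))
                                                  (geom-periodic d (i ∸ j))))
    late : ∀ j → j ≤ d → u (i ℕ.+ suc j) *ᴿ geom d (i ℕ.+ suc d ∸ (i ℕ.+ suc j))
                         ≈ u (i ℕ.+ suc j) *ᴿ geom d (d ∸ j)
    late j _ = *-cong refl (reflexive (cong (geom d) ([m+n]∸[m+o]≡n∸o i (suc d) (suc j))))

  C-periodic : ∀ d a k i → k ℕ.* suc d < i ℕ.+ suc d → C d a (i ℕ.+ suc d) k ≈ C d a i k
  C-periodic d a k i kD<i+D = begin
    C d a (i ℕ.+ suc d) k
      ≈⟨ ·-geom-step d (shiftT (poly d a) ^ₛ k) i ⟩
    C d a i k +ᴿ (shiftT (poly d a) ^ₛ k) (i ℕ.+ suc d)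
      ≈⟨ +-cong refl (^ₛ-vanishesAbove (shiftT-vanishesAbove (poly-vanishesAbove d a)) k _ kD<i+D) ⟩
    C d a i k +ᴿ 0#
      ≈⟨ +-identityʳ _ ⟩
    C d a i k ∎

  C-column0-vanishes : ∀ d a e → 0 < e → e ≤ d → C d a e 0 ≈ 0#
  C-column0-vanishes d a (suc e) _ e<d = ·-geom-≤ d one e<d

open import Data.Integer as ℤ using (ℤ; +_; -[1+_]; _+_; _-_; _*_)
import Data.Integer.Properties as ℤ
open import Data.Integer.Tactic.RingSolver using (solve-∀)

module _ {c ℓ} (R : CommutativeRing c ℓ) where
  open CommutativeRing R using (_≈_; 0#; refl; sym; trans; reflexive)
  open Series R
  open SeriesProperties R

  Cℤ-periodic : ∀ d a k z → (+ k - + 1) * + suc d ℤ.< z → Cℤ d a (z + + suc d) k ≈ Cℤ d a z k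
  Cℤ-periodic d a k (+ i) below = C-periodic d a k i (ℤ.drop‿+<+ kD<i+D)
    where
    kD<i+D : + (k ℕ.* suc d) ℤ.< + i + + suc d
    kD<i+D = ℤ.≤-<-trans (ℤ.≤-reflexive (≡.trans (ℤ.pos-* k (suc d)) (shift (+ k) (+ suc d))))
                         (ℤ.+-monoˡ-< (+ suc d) below)
      where
      shift : ∀ x y → x * y ≡ (x - + 1) * y + y
      shift = solve-∀
  Cℤ-periodic d a (suc k) -[1+ m ] below = ⊥-elim (ℤ.+≮- (≡.subst (ℤ._< -[1+ m ]) nonneg below))
    where
    nonneg : (+ suc k - + 1) * + suc d ≡ + (k ℕ.* suc d)
    nonneg = ≡.trans (drop1 (+ k) (+ suc d)) (≡.sym (ℤ.pos-* k (suc d)))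
      where
      drop1 : ∀ x y → ((+ 1 + x) - + 1) * y ≡ x * y
      drop1 = solve-∀
  Cℤ-periodic d a zero -[1+ m ] below with ≡.subst (ℤ._< -[1+ m ]) (ℤ.-1*i≡-i (+ suc d)) below
  ... | ℤ.-<- m<d = trans (reflexive (cong (λ z → Cℤ d a z 0) (ℤ.⊖-≥ (s≤s (ℕ.<⇒≤ m<d)))))
                         (C-column0-vanishes d a (d ∸ m) (m<n⇒0<n∸m m<d) (m∸n≤m d m))

theorem1 : {c ℓ : Level} (R : CommutativeRing c ℓ) → IsIntegralDomain R →
    (d : ℕ) (a : Fin (suc d) → CommutativeRing.Carrier R) →
    ¬ (CommutativeRing._≈_ R (a (fromℕ d)) (CommutativeRing.0# R)) →
    ¬ (CommutativeRing._≈_ R (a Fin.zero) (CommutativeRing.0# R)) →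
    (k n : ℕ) →
    CommutativeRing._≈_ R
      (Series.Cℤ R d a (+ 1 + (+ k - + 1) * + suc d + + n) k)
      (Series.Cℤ R d a (+ 1 + + k * + suc d + + n) k)
theorem1 R _ d a _ _ k n =
  trans (sym (Cℤ-periodic R d a k start below)) (reflexive (cong (λ z → Cℤ d a z k) (≡.sym next)))
  where
  open CommutativeRing R using (sym; trans; reflexive)
  open Series R
  slope : ℤ
  slope = (+ k - + 1) * + suc d
  start : ℤ
  start = + 1 + slope + + n
  rearrange : ∀ x y z → + 1 + x * y + z ≡ (+ 1 + (x - + 1) * y + z) + y
  rearrange = solve-∀
  next : + 1 + + k * + suc d + + n ≡ start + + suc d
  next = rearrange (+ k) (+ suc d) (+ n)
  reorder : ∀ x z → + 1 + x + z ≡ x + (+ 1 + z)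
  reorder = solve-∀
  below : slope ℤ.< start
  below = ≡.subst₂ ℤ._<_ (ℤ.+-identityʳ slope) (≡.sym (reorder slope (+ n)))
            (ℤ.+-monoʳ-< slope (ℤ.+<+ {0} {suc n} (s≤s z≤n)))
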